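{- Consider four robots executing the algorithm $\mathcal A$ below on a ring of $n>8$ nodes. Let $\gamma$ be a configuration containing a $4$-segment $u_i,u_{i+1},u_{i+2},u_{i+3}$. If $\gamma$ is the configuration at instant $t$, then the configuration at instant $t+1$ is either identical to $\gamma$ or is the configuration containing the primary arrow $u_i,u_{i+1},u_{i+2},u_{i+3}$.
   Context: Model. A ring has $n$ nodes $u_0,\dots,u_{n-1}$ (indices mod $n$), $u_i$ adjacent to $u_{i\pm1}$; nodes anonymous, ring unoriented. Robots are anonymous, uniform, oblivious, non-communicating, and repeatedly run Look–Compute–Move cycles: they see the number of robots on each node (multiplicity detection) relative to their own node and up to orientation, compute (possibly randomly) whether to stay or move to a neighboring node, and move. If a robot's view is symmetric under reversing orientation and it moves, an adversary chooses the edge. At each instant $t=0,1,\dots$ a nonempty set of robots (chosen by a distributed fair scheduler: any nonempty subset, every robot infinitely often) performs a full cycle atomically. A tower is a node with at least two robots; initial configurations are towerless. Definitions. A segment is a maximal nonempty path of occupied nodes; an $x$-segment is one with $x$ nodes; an isolated robot/node is one forming a $1$-segment. A hole is a maximal nonempty path of free nodes; an $x$-hole has $x$ nodes; a neighbor of a hole is a node (or robot on it) not in the hole adjacent to one of its end nodes (extremities). An arrow is a maximal path $u_i,\dots,u_m$ of at least four nodes such that $u_i$ and $u_m$ each hold one robot, $u_{i+1},\dots,u_{m-2}$ are free, and $u_{m-1}$ holds a tower of two robots; $u_i$ is the tail, $u_m$ the head; its size is the number of its free nodes (path length minus 3). An arrow is primary if its size is $1$ and final if its size is $n-4$. "Move"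 means deterministically move; "try to move" means toss a fair coin and move iff it wins. Algorithm $\mathcal A$ (executed by each activated robot): if the robots form a final arrow, do nothing. Otherwise, if the configuration contains neither an arrow nor a $4$-segment, execute Phase I; else if it contains a $4$-segment execute Phase II; else (it contains an arrow) execute Phase III. Phase I: (a) If there is a $3$-segment, the isolated robot moves toward the $3$-segment through the shortest hole. (b) Else if there is a unique $2$-segment (two robots isolated), each isolated robot at the closest distance from the $2$-segment moves toward the $2$-segment through the hole having it and an extremity of the $2$-segment as neighbors. (c) Else if there are exactly two $2$-segments, each robot that is a neighbor of a longest hole tries to move toward the other $2$-segment through its neighboring hole. (d) Else (four isolated robots), let $l_{max}$ be the length of the longest hole: if every robot is a neighbor of an $l_{max}$-hole, each tries to move through a neighboring $l_{max}$-hole; else if three robots are neighbors of an $l_{max}$-hole, each robot neighbor of only one $l_{max}$-hole moves toward the robot that is neighbor of no $l_{max}$-hole through its shortest neighboring hole; else (two robots are neighbors of the unique $l_{max}$-hole) each neighbor of the unique $l_{max}$-hole moves through its shortest neighboring hole. Phase II: a robot not located at an extremity of the $4$-segment tries to move toward its neighboring node that is not an extremity of the $4$-segment. Phase III: the robot at the arrow tail moves toward the arrow head through the hole having it and the arrow head as neighbors. -}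

module Defs where

open import Data.Nat using (ℕ; zero; suc; _+_; _∸_; _≤_; _<_; _%_)
open import Data.Nat.DivMod using (m%n<n)
open import Data.Fin using (Fin; toℕ; fromℕ<; _≟_)
open import Data.List using (List; length; filter; allFin)
open import Data.Bool using (Bool; true; false; if_then_else_)
open import Data.Product using (Σ; ∃; ∃-syntax; _×_; _,_)
open import Data.Sum using (_⊎_)
open import Relation.Nullary using (¬_)
open import Relation.Binary.PropositionalEquality using (_≡_; _≢_)

data Dir : Set where
  cw ccw : Dir          -- cw: index +1 (mod n), ccw: index -1 (mod n)

flip : Dir → Dir
flip cw  = ccw
flip ccw = cw

stepR : ∀ {n} → Dir → Fin n → Fin n
stepR {suc m} cw  i = fromℕ< (m%n<n (suc (toℕ i)) (suc m))
stepR {suc m} ccw i = fromℕ< (m%n<n (toℕ i + m) (suc m))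

walk : ∀ {n} → Dir → Fin n → ℕ → Fin n
walk d a zero    = a
walk d a (suc j) = stepR d (walk d a j)

Config : ℕ → Set
Config n = Fin n → ℕ

-- four (internally labelled) robots; their positions
Positions : ℕ → Set
Positions n = Fin 4 → Fin n

config : ∀ {n} → Positions n → Config n
config pos v = length (filter (λ r → pos r ≟ v) (allFin 4))

data Action : Set where
  stay : Action
  go   : Dir → Action

module _ {n : ℕ} (c : Config n) where

  Occ : Fin n → Set
  Occ v = c v ≢ 0

  Free : Fin n → Set
  Free v = c v ≡ 0

  Seg : Dir → Fin n → ℕ → Set
  Seg d a k = 1 ≤ k × (∀ j → j < k → Occ (walk d a j))
              × Free (walk (flip d) a 1) × Free (walk d a k)

  HasSeg : ℕ → Set
  HasSeg k = ∃[ a ] Seg cw a k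

  UniqueSeg : ℕ → Set
  UniqueSeg k = ∃[ a ] (Seg cw a k × (∀ b → Seg cw b k → b ≡ a))

  ExactlyTwoSeg : ℕ → Set
  ExactlyTwoSeg k = ∃[ a ] ∃[ b ] (a ≢ b × Seg cw a k × Seg cw b k
                     × (∀ x → Seg cw x k → x ≡ a ⊎ x ≡ b))

  In2Seg : Fin n → Set
  In2Seg v = ∃[ a ] (Seg cw a 2 × (v ≡ a ⊎ v ≡ walk cw a 1))

  Isolated : Fin n → Set
  Isolated p = Seg cw p 1

  Hole : Fin n → ℕ → Set
  Hole a k = 1 ≤ k × (∀ j → j < k → Free (walk cw a j))
             × Occ (walk ccw a 1) × Occ (walk cw a k)

  HoleFrom : Fin n → Dir → ℕ → Set
  HoleFrom p d k = Occ p × 1 ≤ k × (∀ j → 1 ≤ j → j ≤ k → Free (walk d p j))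
                   × Occ (walk d p (suc k))

  LMax : ℕ → Set
  LMax l = (∃[ a ] Hole a l) × (∀ a k → Hole a k → k ≤ l)

  -- arrow with tail a, traversed in direction d (tail → head), of size s:
  -- tail a (one robot), s free nodes, a tower of two robots, head (one robot)
  ArrowAt : Dir → Fin n → ℕ → Set
  ArrowAt d a s = 1 ≤ s × s + 3 ≤ n × c a ≡ 1
                  × (∀ j → 1 ≤ j → j ≤ s → Free (walk d a j))
                  × c (walk d a (suc s)) ≡ 2 × c (walk d a (suc (suc s))) ≡ 1

  HasArrow : Set
  HasArrow = ∃[ d ] ∃[ a ] ∃[ s ] ArrowAt d a s

  -- primary arrow: size 1; final arrow: size n - 4
  FinalArrow : Set
  FinalArrow = ∃[ d ] ∃[ a ] ArrowAt d a (n ∸ 4)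

  PhaseI PhaseII PhaseIII : Set
  PhaseI   = ¬ FinalArrow × ¬ HasArrow × ¬ HasSeg 4
  PhaseII  = ¬ FinalArrow × HasSeg 4
  PhaseIII = ¬ FinalArrow × ¬ HasSeg 4 × HasArrow

  CaseA CaseB CaseC CaseD : Set
  CaseA = PhaseI × HasSeg 3
  CaseB = PhaseI × ¬ HasSeg 3 × UniqueSeg 2
  CaseC = PhaseI × ¬ HasSeg 3 × ¬ UniqueSeg 2 × ExactlyTwoSeg 2
  CaseD = PhaseI × ¬ HasSeg 3 × ¬ UniqueSeg 2 × ¬ ExactlyTwoSeg 2

  NbrL : ℕ → Fin n → Set
  NbrL l q = ∃[ e ] HoleFrom q e l

  AllNbr : ℕ → Set
  AllNbr l = ∀ q → Occ q → NbrL l q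

  -- exactly one robot is neighbour of no l-hole (i.e. three robots are)
  ThreeNbr : ℕ → Set
  ThreeNbr l = ∃[ q ] (Occ q × ¬ NbrL l q
                × (∀ q′ → Occ q′ → ¬ NbrL l q′ → q′ ≡ q))

  ShortestDir : Fin n → Dir → Set
  ShortestDir p d = ∃[ k ] ∃[ k′ ] (HoleFrom p d k × HoleFrom p (flip d) k′ × k ≤ k′)

  -- "the robot on p moves in direction d" (deterministic; if several d are
  -- admissible, the adversary chooses)
  data Must : Fin n → Dir → Set where
    mustA : ∀ {p d} → CaseA → Isolated p → ShortestDir p d → Must p d
    mustB : ∀ {p d k} → CaseB → Isolated p → HoleFrom p d k
            → In2Seg (walk d p (suc k))
            → (∀ q e k′ → Isolated q → HoleFrom q e k′
                  → In2Seg (walk e q (suc k′)) → k ≤ k′)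
            → Must p d
    mustD2 : ∀ {p d l} → CaseD → LMax l → ¬ AllNbr l → ThreeNbr l
             → NbrL l p → ¬ (HoleFrom p cw l × HoleFrom p ccw l)
             → ShortestDir p d → Must p d
    mustD3 : ∀ {p d l} → CaseD → LMax l → ¬ AllNbr l → ¬ ThreeNbr l
             → NbrL l p → ShortestDir p d → Must p d
    mustIII : ∀ {p d s} → PhaseIII → ArrowAt d p s → Must p (flip d)

  -- "the robot on p tries to move in direction d" (fair coin)
  data Try : Fin n → Dir → Set where
    tryC : ∀ {p d l} → CaseC → LMax l → HoleFrom p d l → Try p d
    tryD1 : ∀ {p d l} → CaseD → LMax l → AllNbr l → HoleFrom p d l → Try p d
    tryII : ∀ {p d a} → PhaseII → Seg d a 4 → p ≡ walk d a 1 → Try p d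

  Allowed : Fin n → Action → Set
  Allowed p stay   = ¬ (∃[ d ] Must p d)
  Allowed p (go d) = Must p d ⊎ Try p d

apply : ∀ {n} → Action → Fin n → Fin n
apply stay   v = v
apply (go d) v = stepR d v

-- One instant: a nonempty set of robots performs a full cycle atomically,
-- all of them looking at the current configuration.

Step : ∀ {n} → Positions n → Positions n → Set
Step {n} pos pos′ =
  Σ (Fin 4 → Bool) λ act →
  Σ (Fin 4 → Action) λ a →
    (∃[ r ] act r ≡ true)
    × (∀ r → act r ≡ true → Allowed (config pos) (pos r) (a r))
    × (∀ r → pos′ r ≡ (if act r then apply (a r) (pos r) else pos r))

-- Since there are four robots, the four nodes of the 4-segment hold exactly
-- one robot each and every robot lies on the segment.  A 4-segment rules out
-- Phases I and III, so no robot is obliged to move, and in Phase II only the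
-- two inner robots may move, each towards the other's node.  The four
-- outcomes of their coin tosses give: no move or a swap (the configuration is
-- unchanged), or exactly one of them joining the other, which creates a tower
-- flanked by a free node and an outer robot, i.e. a primary arrow.
module Submission where

open import Data.Bool using (true; false)
open import Data.Empty using (⊥-elim)
open import Data.Fin using (Fin; toℕ; _≟_; punchOut)
open import Data.Fin.Patterns using (0F; 1F; 2F; 3F)
open import Data.Fin.Properties
  using (toℕ-fromℕ<; toℕ-injective; toℕ<n; any?; punchOut-injective; injective⇒≤)
open import Data.List using ([]; _∷_; length; filter; allFin)
open import Data.List.Properties using (filter-≐)
open import Data.Nat using (ℕ; zero; suc; _+_; _∸_; _≤_; _<_; _%_; s≤s; z≤n)
open import Data.Nat.DivMod using (m%n<n; %-distribˡ-+; m%n%n≡m%n; [m+n]%n≡m%n; m<n⇒m%n≡m)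
open import Data.Nat.Properties
  using (+-identityʳ; +-suc; suc-injective; +-monoˡ-<; m+[n∸m]≡n; <⇒≤; <-trans; m≤n⇒m<n∨m≡n; n<1+n; <-cmp; <-irrefl)
open import Data.Product using (∃-syntax; _×_; _,_; proj₁; proj₂)
open import Data.Sum using (_⊎_; inj₁; inj₂; [_,_]; swap)
open import Function.Definitions using (Injective)
open import Level using (0ℓ)
open import Relation.Binary.Definitions using (tri<; tri≈; tri>)
open import Relation.Binary.PropositionalEquality hiding ([_])
open import Relation.Nullary using (¬_; yes; no; contradiction)
open import Relation.Nullary.Decidable using (_⊎-dec_)
open import Relation.Unary using (Pred; Decidable; _≐_)

open import Defs

stepR-ccw-cw : ∀ {n} (x : Fin n) → stepR ccw (stepR cw x) ≡ x
stepR-ccw-cw {suc m} x = toℕ-injective (begin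
  toℕ (stepR ccw (stepR cw x)) ≡⟨ toℕ-fromℕ< _ ⟩
  (toℕ (stepR cw x) + m) % N   ≡⟨ cong (λ y → (y + m) % N) (toℕ-fromℕ< (m%n<n (suc (toℕ x)) N)) ⟩
  (suc (toℕ x) % N + m) % N   ≡⟨ mod-absorbˡ (suc (toℕ x)) m ⟩
  (suc (toℕ x) + m) % N       ≡⟨ cong (_% N) (sym (+-suc (toℕ x) m)) ⟩
  (toℕ x + N) % N             ≡⟨ [m+n]%n≡m%n (toℕ x) N ⟩
  toℕ x % N                   ≡⟨ m<n⇒m%n≡m (toℕ<n x) ⟩
  toℕ x                       ∎)
  where
  open ≡-Reasoning
  N : ℕ
  N = suc m
  mod-absorbˡ : ∀ a b → (a % N + b) % N ≡ (a + b) % N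
  mod-absorbˡ a b = begin
    (a % N + b) % N           ≡⟨ %-distribˡ-+ (a % N) b N ⟩
    (a % N % N + b % N) % N   ≡⟨ cong (λ y → (y + b % N) % N) (m%n%n≡m%n a N) ⟩
    (a % N + b % N) % N       ≡⟨ %-distribˡ-+ a b N ⟨
    (a + b) % N               ∎

walk-+ : ∀ {n} d (a : Fin n) i j → walk d (walk d a i) j ≡ walk d a (i + j)
walk-+ d a i zero    = cong (walk d a) (sym (+-identityʳ i))
walk-+ d a i (suc j) = trans (cong (stepR d) (walk-+ d a i j)) (cong (walk d a) (sym (+-suc i j)))

walk-ccw-cw : ∀ {n} (a : Fin n) j k → walk ccw (walk cw a (j + k)) j ≡ walk cw a k
walk-ccw-cw a zero    k = refl
walk-ccw-cw a (suc j) k = begin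
  walk ccw (stepR cw (walk cw a (j + k))) (suc j)              ≡⟨ walk-+ ccw _ 1 j ⟨
  walk ccw (stepR ccw (stepR cw (walk cw a (j + k)))) j        ≡⟨ cong (λ x → walk ccw x j) (stepR-ccw-cw _) ⟩
  walk ccw (walk cw a (j + k)) j                               ≡⟨ walk-ccw-cw a j k ⟩
  walk cw a k                                                  ∎
  where open ≡-Reasoning

injective⇒surjective : ∀ {n} {f : Fin n → Fin n} → Injective _≡_ _≡_ f → ∀ y → ∃[ x ] f x ≡ y
injective⇒surjective {suc m} {f} f-inj y with any? (λ x → f x ≟ y)
... | yes hit = hit
... | no miss = ⊥-elim (<-irrefl refl (injective⇒≤ punched-injective))
  where
  punched : Fin (suc m) → Fin m
  punched x = punchOut {i = y} (λ e → miss (x , sym e))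
  punched-injective : Injective _≡_ _≡_ punched
  punched-injective e = f-inj (punchOut-injective {i = y} _ _ e)

length-filter-⊎ : ∀ {A : Set} {P Q : Pred A 0ℓ} (P? : Decidable P) (Q? : Decidable Q) →
                  (∀ x → P x → ¬ Q x) → ∀ xs →
                  length (filter (λ x → P? x ⊎-dec Q? x) xs)
                    ≡ length (filter P? xs) + length (filter Q? xs)
length-filter-⊎ P? Q? disjoint [] = refl
length-filter-⊎ P? Q? disjoint (x ∷ xs) with P? x | Q? x | length-filter-⊎ P? Q? disjoint xs
... | yes p | yes q | _  = ⊥-elim (disjoint x p q)
... | yes _ | no _  | ih = cong suc ih
... | no _  | yes _ | ih = trans (cong suc ih) (sym (+-suc _ _))
... | no _  | no _  | ih = ih

length-filter-≟ : (r : Fin 4) → length (filter (_≟ r) (allFin 4)) ≡ 1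
length-filter-≟ 0F = refl
length-filter-≟ 1F = refl
length-filter-≟ 2F = refl
length-filter-≟ 3F = refl

module Counting {n} (pos : Positions n) (v : Fin n) where

  config-≐ : ∀ {P : Pred (Fin 4) 0ℓ} (P? : Decidable P) →
             (λ r → pos r ≡ v) ≐ P → config pos v ≡ length (filter P? (allFin 4))
  config-≐ P? eq = cong length (filter-≐ (λ r → pos r ≟ v) P? eq (allFin 4))

  config≡0 : (∀ r → pos r ≢ v) → config pos v ≡ 0
  config≡0 none = config-≐ (λ _ → no (λ ())) ((λ {r} e → none r e) , λ ())

  config≡1 : ∀ {r} → pos r ≡ v → (∀ q → pos q ≡ v → q ≡ r) → config pos v ≡ 1
  config≡1 {r} at only = trans (config-≐ (_≟ r) ((λ {q} → only q) , λ { refl → at })) (length-filter-≟ r)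

  config≡2 : ∀ {r r′} → r ≢ r′ → pos r ≡ v → pos r′ ≡ v →
             (∀ q → pos q ≡ v → q ≡ r ⊎ q ≡ r′) → config pos v ≡ 2
  config≡2 {r} {r′} r≢r′ at at′ only = begin
    config pos v                                      ≡⟨ config-≐ pair ((λ {q} → only q) , at-pair) ⟩
    length (filter pair (allFin 4))                   ≡⟨ length-filter-⊎ (_≟ r) (_≟ r′) disjoint (allFin 4) ⟩
    length (filter (_≟ r) (allFin 4)) + length (filter (_≟ r′) (allFin 4))
                                                      ≡⟨ cong₂ _+_ (length-filter-≟ r) (length-filter-≟ r′) ⟩
    2                                                 ∎
    where
    open ≡-Reasoning
    pair : Decidable (λ q → q ≡ r ⊎ q ≡ r′)
    pair q = q ≟ r ⊎-dec q ≟ r′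
    at-pair : ∀ {q} → q ≡ r ⊎ q ≡ r′ → pos q ≡ v
    at-pair (inj₁ refl) = at
    at-pair (inj₂ refl) = at′
    disjoint : ∀ q → q ≡ r → ¬ q ≡ r′
    disjoint q refl = r≢r′

  config≡1-of-pair : ∀ {r r′} → pos r ≡ v → pos r′ ≢ v → (∀ q → pos q ≡ v → q ≡ r ⊎ q ≡ r′) →
              config pos v ≡ 1
  config≡1-of-pair {r} {r′} at not-at only = config≡1 at (λ q e → sole (only q e) e)
    where
    sole : ∀ {q} → q ≡ r ⊎ q ≡ r′ → pos q ≡ v → q ≡ r
    sole (inj₁ q≡r) _ = q≡r
    sole (inj₂ refl) e = ⊥-elim (not-at e)

  occupied⇒robot : config pos v ≢ 0 → ∃[ r ] pos r ≡ v
  occupied⇒robot occ with any? (λ r → pos r ≟ v)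
  ... | yes found = found
  ... | no none   = contradiction (config≡0 (λ r e → none (r , e))) occ

open Counting

module Segments {n} (c : Config n) where

  seg-no-repeat : ∀ {a k i j} → Seg c cw a k → i < j → j ≤ k → walk cw a i ≢ walk cw a j
  seg-no-repeat {a} {k} {i} {j} (_ , occ , _ , end-free) i<j j≤k e =
    occ (i + m) (subst (i + m <_) (m+[n∸m]≡n j≤k) (+-monoˡ-< m i<j)) (trans (cong c loop) end-free)
    where
    open ≡-Reasoning
    m : ℕ
    m = k ∸ j
    loop : walk cw a (i + m) ≡ walk cw a k
    loop = begin
      walk cw a (i + m)         ≡⟨ walk-+ cw a i m ⟨
      walk cw (walk cw a i) m   ≡⟨ cong (λ x → walk cw x m) e ⟩
      walk cw (walk cw a j) m   ≡⟨ walk-+ cw a j m ⟩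
      walk cw a (j + m)         ≡⟨ cong (walk cw a) (m+[n∸m]≡n j≤k) ⟩
      walk cw a k               ∎

  seg-walk-injective : ∀ {a k i j} → Seg c cw a k → i < k → j < k → walk cw a i ≡ walk cw a j → i ≡ j
  seg-walk-injective {i = i} {j} seg i<k j<k e with <-cmp i j
  ... | tri< i<j _ _ = ⊥-elim (seg-no-repeat seg i<j (<⇒≤ j<k) e)
  ... | tri≈ _ i≡j _ = i≡j
  ... | tri> _ _ j<i = ⊥-elim (seg-no-repeat seg j<i (<⇒≤ i<k) (sym e))

  seg-start : ∀ {a k k′} j → Seg c cw a k → j < k → Seg c cw (walk cw a j) k′ → j ≡ 0
  seg-start zero    _                 _   _                      = refl
  seg-start (suc i) (_ , occ , _ , _) j<k (_ , _ , pred-free , _) =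
    ⊥-elim (occ i (<-trans (n<1+n i) j<k) (trans (cong c (sym (stepR-ccw-cw _))) pred-free))

  seg-end : ∀ {a k k′} j → Seg c cw a k → j < k → Seg c ccw (walk cw a j) k′ → suc j ≡ k
  seg-end j (_ , occ , _ , _) j<k (_ , _ , next-free , _) with m≤n⇒m<n∨m≡n j<k
  ... | inj₁ 1+j<k = ⊥-elim (occ (suc j) 1+j<k next-free)
  ... | inj₂ 1+j≡k = 1+j≡k

  must⇒¬HasSeg4 : ∀ {p d} → Must c p d → ¬ HasSeg c 4
  must⇒¬HasSeg4 (mustA ((_ , _ , ¬seg4) , _) _ _)           = ¬seg4
  must⇒¬HasSeg4 (mustB ((_ , _ , ¬seg4) , _) _ _ _ _)       = ¬seg4
  must⇒¬HasSeg4 (mustD2 ((_ , _ , ¬seg4) , _) _ _ _ _ _ _)  = ¬seg4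
  must⇒¬HasSeg4 (mustD3 ((_ , _ , ¬seg4) , _) _ _ _ _ _)    = ¬seg4
  must⇒¬HasSeg4 (mustIII (_ , ¬seg4 , _) _)                 = ¬seg4

  phaseII-go : ∀ {p d} → HasSeg c 4 → Allowed c p (go d) → ∃[ a ] (Seg c d a 4 × p ≡ walk d a 1)
  phaseII-go seg4 (inj₁ must)                                = ⊥-elim (must⇒¬HasSeg4 must seg4)
  phaseII-go seg4 (inj₂ (tryC ((_ , _ , ¬seg4) , _) _ _))    = ⊥-elim (¬seg4 seg4)
  phaseII-go seg4 (inj₂ (tryD1 ((_ , _ , ¬seg4) , _) _ _ _)) = ⊥-elim (¬seg4 seg4)
  phaseII-go _    (inj₂ (tryII {a = a} _ seg p≡))            = a , seg , p≡

primary-arrow : ∀ {n} (c : Config n) {d a} → 4 ≤ n → c a ≡ 1 → c (walk d a 1) ≡ 0 →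
                c (walk d a 2) ≡ 2 → c (walk d a 3) ≡ 1 → ArrowAt c d a 1
primary-arrow c 4≤n tail free tower head = s≤s z≤n , 4≤n , tail , gap , tower , head
  where
  gap : ∀ j → 1 ≤ j → j ≤ 1 → Free c (walk _ _ j)
  gap 1             _ _          = free
  gap (suc (suc _)) _ (s≤s ())

step-robot : ∀ {n} {pos pos′ : Positions n} → Step pos pos′ → ∀ r →
             pos′ r ≡ pos r ⊎ ∃[ d ] (Allowed (config pos) (pos r) (go d) × pos′ r ≡ stepR d (pos r))
step-robot (act , α , _ , allowed , moved) r with act r | α r | allowed r | moved r
... | false | _    | _  | e = inj₁ e
... | true  | stay | _  | e = inj₁ e
... | true  | go d | ok | e = inj₂ (d , ok refl , e)

module FourSegment {n} (pos : Positions n) {u : Fin n} (seg : Seg (config pos) cw u 4) where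

  c : Config n
  c = config pos

  open Segments c

  W : Fin 4 → Fin n
  W k = walk cw u (toℕ k)

  W-injective : Injective _≡_ _≡_ W
  W-injective e = toℕ-injective (seg-walk-injective seg (toℕ<n _) (toℕ<n _) e)

  W-occupied : ∀ k → Occ c (W k)
  W-occupied k = proj₁ (proj₂ seg) (toℕ k) (toℕ<n k)

  robot : Fin 4 → Fin 4
  robot k = proj₁ (occupied⇒robot pos (W k) (W-occupied k))

  robot-at : ∀ k → pos (robot k) ≡ W k
  robot-at k = proj₂ (occupied⇒robot pos (W k) (W-occupied k))

  robot-injective : Injective _≡_ _≡_ robot
  robot-injective {i} {j} e = W-injective (trans (sym (robot-at i)) (trans (cong pos e) (robot-at j)))

  at-W : ∀ {r} k → pos r ≡ W k → r ≡ robot k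
  at-W {r} k e with injective⇒surjective robot-injective r
  ... | k′ , refl = cong robot (W-injective {k′} {k} (trans (sym (robot-at k′)) e))

  on-segment : ∀ v → Occ c v → ∃[ k ] v ≡ W k
  on-segment v occ with occupied⇒robot pos v occ
  ... | r , refl with injective⇒surjective robot-injective r
  ... | k , refl = k , robot-at k

  c-W≡1 : ∀ k → c (W k) ≡ 1
  c-W≡1 k = config≡1 pos (W k) (robot-at k) (λ q → at-W k)

  inner-move : ∀ {p d} → Allowed c p (go d) →
               (p ≡ W 1F × stepR d p ≡ W 2F) ⊎ (p ≡ W 2F × stepR d p ≡ W 1F)
  inner-move allowed with phaseII-go (u , seg) allowed
  ... | a , seg′ , p≡ with on-segment a (proj₁ (proj₂ seg′) 0 (s≤s z≤n))
  inner-move {d = cw} _ | _ , seg′ , refl | k , refl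
    rewrite seg-start (toℕ k) seg (toℕ<n k) seg′ = inj₁ (refl , refl)
  inner-move {d = ccw} _ | _ , seg′ , refl | k , refl
    rewrite suc-injective (seg-end (toℕ k) seg (toℕ<n k) seg′) = inj₂ (walk-ccw-cw u 1 2 , walk-ccw-cw u 2 1)

  4≤n : 4 ≤ n
  4≤n = injective⇒≤ W-injective

  W₁≢W₂ : W 1F ≢ W 2F
  W₁≢W₂ e with W-injective {1F} {2F} e
  ... | ()

  W₁⇒≢W₂ : ∀ {x} → x ≡ W 1F → x ≢ W 2F
  W₁⇒≢W₂ e e′ = W₁≢W₂ (trans (sym e) e′)

  W₂⇒≢W₁ : ∀ {x} → x ≡ W 2F → x ≢ W 1F
  W₂⇒≢W₁ e e′ = W₁≢W₂ (trans (sym e′) e)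

  module After {pos′ : Positions n} (st : Step pos pos′) where

    c′ : Config n
    c′ = config pos′

    R₁ R₂ : Fin 4
    R₁ = robot 1F
    R₂ = robot 2F

    Inner : Fin n → Set
    Inner v = v ≡ W 1F ⊎ v ≡ W 2F

    moves : ∀ r → pos′ r ≡ pos r ⊎ (pos r ≡ W 1F × pos′ r ≡ W 2F) ⊎ (pos r ≡ W 2F × pos′ r ≡ W 1F)
    moves r with step-robot st r
    ... | inj₁ stays = inj₁ stays
    ... | inj₂ (d , allowed , e) with inner-move allowed
    ...   | inj₁ (at₁ , to₂) = inj₂ (inj₁ (at₁ , trans e to₂))
    ...   | inj₂ (at₂ , to₁) = inj₂ (inj₂ (at₂ , trans e to₁))

    inner-robot : ∀ {q v} → Inner v → pos q ≡ v → q ≡ R₁ ⊎ q ≡ R₂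
    inner-robot (inj₁ refl) e = inj₁ (at-W 1F e)
    inner-robot (inj₂ refl) e = inj₂ (at-W 2F e)

    inner-or-stays : ∀ r → (r ≡ R₁ ⊎ r ≡ R₂) ⊎ pos′ r ≡ pos r
    inner-or-stays r with moves r
    ... | inj₁ stays           = inj₂ stays
    ... | inj₂ (inj₁ (at , _)) = inj₁ (inner-robot (inj₁ refl) at)
    ... | inj₂ (inj₂ (at , _)) = inj₁ (inner-robot (inj₂ refl) at)

    starts : ∀ {r} → r ≡ R₁ ⊎ r ≡ R₂ → Inner (pos r)
    starts (inj₁ refl) = inj₁ (robot-at 1F)
    starts (inj₂ refl) = inj₂ (robot-at 2F)

    lands : ∀ {r} → r ≡ R₁ ⊎ r ≡ R₂ → Inner (pos′ r)
    lands {r} r-inner with moves r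
    ... | inj₁ stays          = subst Inner (sym stays) (starts r-inner)
    ... | inj₂ (inj₁ (_ , e)) = inj₂ e
    ... | inj₂ (inj₂ (_ , e)) = inj₁ e

    arrivals : ∀ {x} → Inner x → ∀ q → pos′ q ≡ x → q ≡ R₁ ⊎ q ≡ R₂
    arrivals x-inner q e with inner-or-stays q
    ... | inj₁ q-inner = q-inner
    ... | inj₂ stays   = inner-robot x-inner (trans (sym stays) e)

    outer-unchanged : ∀ {v} → ¬ Inner v → c′ v ≡ c v
    outer-unchanged {v} outer = sym (config-≐ pos v (λ r → pos′ r ≟ v) (to , from))
      where
      to : ∀ {r} → pos r ≡ v → pos′ r ≡ v
      to {r} e with inner-or-stays r
      ... | inj₁ r-inner = ⊥-elim (outer (subst Inner e (starts r-inner)))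
      ... | inj₂ stays   = trans stays e
      from : ∀ {r} → pos′ r ≡ v → pos r ≡ v
      from {r} e with inner-or-stays r
      ... | inj₁ r-inner = ⊥-elim (outer (subst Inner e (lands r-inner)))
      ... | inj₂ stays   = trans (sym stays) e

    unchanged : c′ (W 1F) ≡ 1 → c′ (W 2F) ≡ 1 → ∀ v → c′ v ≡ c v
    unchanged one₁ one₂ v with v ≟ W 1F | v ≟ W 2F
    ... | yes refl | _        = trans one₁ (sym (c-W≡1 1F))
    ... | no _     | yes refl = trans one₂ (sym (c-W≡1 2F))
    ... | no v≢W₁  | no v≢W₂  = outer-unchanged [ v≢W₁ , v≢W₂ ]

    outer-W≡1 : ∀ k → k ≢ 1F → k ≢ 2F → c′ (W k) ≡ 1
    outer-W≡1 k k≢1 k≢2 =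
      trans (outer-unchanged [ (λ e → k≢1 (W-injective e)) , (λ e → k≢2 (W-injective e)) ]) (c-W≡1 k)

    absent : ∀ {x} → Inner x → pos′ R₁ ≢ x → pos′ R₂ ≢ x → c′ x ≡ 0
    absent x-inner ≢₁ ≢₂ = config≡0 pos′ _ (λ q e → not-here (arrivals x-inner q e) e)
      where
      not-here : ∀ {q} → q ≡ R₁ ⊎ q ≡ R₂ → pos′ q ≢ _
      not-here (inj₁ refl) = ≢₁
      not-here (inj₂ refl) = ≢₂

    tower : ∀ {x} → Inner x → pos′ R₁ ≡ x → pos′ R₂ ≡ x → c′ x ≡ 2
    tower x-inner e₁ e₂ = config≡2 pos′ _ R₁≢R₂ e₁ e₂ (arrivals x-inner)
      where
      R₁≢R₂ : R₁ ≢ R₂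
      R₁≢R₂ e = W₁≢W₂ (trans (sym (robot-at 1F)) (trans (cong pos e) (robot-at 2F)))

    step-outcome : (∀ v → c′ v ≡ c v) ⊎ (ArrowAt c′ cw u 1 ⊎ ArrowAt c′ ccw (W 3F) 1)
    step-outcome with lands (inj₁ refl) | lands (inj₂ refl)
    ... | inj₁ R₁↦W₁ | inj₂ R₂↦W₂ = inj₁ (unchanged
          (config≡1-of-pair pos′ _ R₁↦W₁ (W₂⇒≢W₁ R₂↦W₂) (arrivals (inj₁ refl)))
          (config≡1-of-pair pos′ _ R₂↦W₂ (W₁⇒≢W₂ R₁↦W₁) (λ q e → swap (arrivals (inj₂ refl) q e))))
    ... | inj₂ R₁↦W₂ | inj₁ R₂↦W₁ = inj₁ (unchanged
          (config≡1-of-pair pos′ _ R₂↦W₁ (W₂⇒≢W₁ R₁↦W₂) (λ q e → swap (arrivals (inj₁ refl) q e)))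
          (config≡1-of-pair pos′ _ R₁↦W₂ (W₁⇒≢W₂ R₂↦W₁) (arrivals (inj₂ refl))))
    ... | inj₂ R₁↦W₂ | inj₂ R₂↦W₂ = inj₂ (inj₁ (primary-arrow c′ 4≤n
          (outer-W≡1 0F (λ ()) (λ ()))
          (absent (inj₁ refl) (W₂⇒≢W₁ R₁↦W₂) (W₂⇒≢W₁ R₂↦W₂))
          (tower (inj₂ refl) R₁↦W₂ R₂↦W₂)
          (outer-W≡1 3F (λ ()) (λ ()))))
    ... | inj₁ R₁↦W₁ | inj₁ R₂↦W₁ = inj₂ (inj₂ (primary-arrow c′ 4≤n
          (outer-W≡1 3F (λ ()) (λ ()))
          (trans (cong c′ (walk-ccw-cw u 1 2)) (absent (inj₂ refl) (W₁⇒≢W₂ R₁↦W₁) (W₁⇒≢W₂ R₂↦W₁)))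
          (trans (cong c′ (walk-ccw-cw u 2 1)) (tower (inj₁ refl) R₁↦W₁ R₂↦W₁))
          (trans (cong c′ (walk-ccw-cw u 3 0)) (outer-W≡1 0F (λ ()) (λ ())))))

lemma8 : (n : ℕ) → 8 < n → (pos pos′ : Positions n) → (u : Fin n)
       → Seg (config pos) cw u 4
       → Step pos pos′
       → (∀ v → config pos′ v ≡ config pos v)
         ⊎ (ArrowAt (config pos′) cw u 1 ⊎ ArrowAt (config pos′) ccw (walk cw u 3) 1)
lemma8 n _ pos pos′ u seg st = FourSegment.After.step-outcome pos seg st
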